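{- Let $n\geq 1$ and let $\mathcal{F}$ be a family of subsets of $\{1,2,\ldots,n\}$. For $F,F'\in\mathcal{F}$ let $d(F,F')$ denote the cardinality of the symmetric difference $F\oplus F'=(F\setminus F')\cup(F'\setminus F)$. If for every two distinct $F,F'\in\mathcal{F}$ the number $d(F,F')$ is not a multiple of $4$, then $$|\mathcal{F}|\leq\begin{cases}2n, & n\equiv 0,1,2 \pmod 4,\\ 2n+2, & n\equiv 3\pmod 4.\end{cases}$$ Moreover, this bound is sharp: for every $n$ there exists such a family $\mathcal{F}$ attaining it. -}

module Defs where

open import Data.Nat using (ℕ; _+_; _*_; _%_)
open import Data.Nat.Divisibility using (_∣_)
open import Data.Fin.Subset using (Subset; _∪_; _─_; ∣_∣)
open import Data.List using (List)
open import Data.List.Relation.Unary.AllPairs using (AllPairs)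
open import Relation.Binary.PropositionalEquality using (_≡_)
open import Relation.Nullary using (¬_)

d : ∀ {n} → Subset n → Subset n → ℕ
d F F′ = ∣ (F ─ F′) ∪ (F′ ─ F) ∣

-- A family of subsets of {1..n}, represented as a list; the hypothesis
-- "d(F,F') is not a multiple of 4 for distinct F, F'" is imposed on all
-- pairs of list positions. (This forces the list entries to be distinct,
-- since d(F,F) = 0 is a multiple of 4, so length = |𝓕|.)
Good : ∀ {n} → List (Subset n) → Set
Good 𝓕 = AllPairs (λ F F′ → ¬ (4 ∣ d F F′)) 𝓕

bound : ℕ → ℕ
bound n with n % 4
... | 3 = 2 * n + 2
... | _ = 2 * n

module Submission where

-- Subsets are vectors of GF(2)ⁿ, weights are taken in ℤ₄, and everything rests
-- on |v ⊕ w| ≡ |v| + |w| + 2⟨v,w⟩ (mod 4) with ⟨v,w⟩ = |v ∩ w| mod 2.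
-- Upper bound: split 𝓕 by the parity of |F|. Inside one class all distances
-- are ≡ 2 (mod 4), and translating by one member yields a "two-code" (weights
-- and distances ≡ 2) whose GF(2) Gram matrix is J + I. For even size J + I is
-- invertible, so the code is independent in the (n-1)-dimensional even subspace
-- (dimension bounds come from counting: injective Subset k → Subset n gives
-- k ≤ n). Hence two-codes have ≤ n members, and ≤ n - 1 unless n ≡ 3 (mod 4);
-- each parity class has ≤ classBound n members.
-- Sharpness: singletons (plus the full set when n ≡ 3) form an odd two-code C,
-- and C together with its translate by a singleton attains 2·classBound n.

open import Defs
open import Data.Bool using (Bool; true; false; not; _xor_; _∧_)
import Data.Bool as Bool
open import Data.Bool.Properties
  using (not-involutive; xor-assoc; xor-comm; xor-identityˡ; xor-identityʳ; xor-same;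
         ∧-distribʳ-xor; ∧-zeroʳ; not-¬; ¬-not)
open import Data.Empty using (⊥-elim)
open import Data.Nat using (ℕ; zero; suc; _+_; _*_; _%_; _^_; _≤_; _<_; z≤n; s≤s; _≟_)
open import Data.Nat.DivMod using ([m+n]%n≡m%n)
open import Data.Nat.Divisibility using (_∣_; m%n≡0⇒n∣m; n∣m⇒m%n≡0)
open import Data.Nat.Properties
  using (+-comm; +-suc; +-identityʳ; +-mono-≤; ≮⇒≥; <⇒≱; ^-monoʳ-<;
         m≤n⇒m≤1+n; ≤∧≢⇒<; ≤-pred; 1+n≰n; <-irrefl)
open import Data.Fin using (Fin; zero; suc; combine; funToFin; finToFun)
open import Data.Fin.Properties using (2↔Bool; finToFun-funToFin; funToFin-finToFin; injective⇒≤)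
open import Data.Fin.Subset using (Subset; ⊥; ⊤; ⁅_⁆; _∩_; _─_; _∪_; ∣_∣)
open import Data.Fin.Subset.Properties
  using (∩-comm; ∩-idem; ∩-identityʳ; ∩-zeroˡ; ∣⊥∣≡0; ∣⊤∣≡n; ∣⁅x⁆∣≡1)
open import Data.Vec using ([]; _∷_; zipWith; lookup; replicate)
import Data.Vec as Vec
open import Data.Vec.Properties
  using (zipWith-assoc; zipWith-comm; zipWith-identityˡ; zipWith-identityʳ; zipWith-distribʳ;
         zipWith-replicate; tabulate∘lookup; tabulate-cong; lookup∘tabulate; map-id)
open import Data.Product using (_×_; Σ; _,_)
open import Data.List using (List; []; _∷_; length; map; filter; tabulate; _++_)
open import Data.List.Properties using (length-map; length-++; length-tabulate)
open import Data.List.Relation.Unary.All using (All; []; _∷_)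
import Data.List.Relation.Unary.All as All
open import Data.List.Relation.Unary.All.Properties
  using (all-filter; tabulate⁺) renaming (map⁺ to All-map⁺)
open import Data.List.Relation.Unary.AllPairs using (AllPairs; []; _∷_)
import Data.List.Relation.Unary.AllPairs as AllPairs
open import Data.List.Relation.Unary.AllPairs.Properties
  using (++⁺; filter⁺) renaming (map⁺ to AllPairs-map⁺; tabulate⁺ to AllPairs-tabulate⁺)
open import Function.Bundles using (Inverse)
open import Relation.Nullary using (¬_; yes; no)
open import Relation.Unary using (Decidable)
open import Relation.Unary.Properties using (∁?)
open import Relation.Binary.PropositionalEquality
  using (_≡_; _≢_; _≗_; refl; sym; trans; cong; cong₂; subst; subst₂; module ≡-Reasoning)
open ≡-Reasoning

private variable n m k : ℕ

data ℤ₄ : Set where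
  0₄ 1₄ 2₄ 3₄ : ℤ₄

inc : ℤ₄ → ℤ₄
inc 0₄ = 1₄
inc 1₄ = 2₄
inc 2₄ = 3₄
inc 3₄ = 0₄

inc⁴ : ∀ x → inc (inc (inc (inc x))) ≡ x
inc⁴ 0₄ = refl
inc⁴ 1₄ = refl
inc⁴ 2₄ = refl
inc⁴ 3₄ = refl

infixl 6 _+₄_
_+₄_ : ℤ₄ → ℤ₄ → ℤ₄
0₄ +₄ y = y
1₄ +₄ y = inc y
2₄ +₄ y = inc (inc y)
3₄ +₄ y = inc (inc (inc y))

+₄-incˡ : ∀ x y → inc x +₄ y ≡ inc (x +₄ y)
+₄-incˡ 0₄ y = refl
+₄-incˡ 1₄ y = refl
+₄-incˡ 2₄ y = refl
+₄-incˡ 3₄ y = sym (inc⁴ y)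

+₄-incʳ : ∀ x y → x +₄ inc y ≡ inc (x +₄ y)
+₄-incʳ 0₄ y = refl
+₄-incʳ 1₄ y = refl
+₄-incʳ 2₄ y = refl
+₄-incʳ 3₄ y = refl

+₄-identityʳ : ∀ x → x +₄ 0₄ ≡ x
+₄-identityʳ 0₄ = refl
+₄-identityʳ 1₄ = refl
+₄-identityʳ 2₄ = refl
+₄-identityʳ 3₄ = refl

[_]₄ : ℕ → ℤ₄
[ zero ]₄ = 0₄
[ suc k ]₄ = inc [ k ]₄

residue : ℤ₄ → ℕ
residue 0₄ = 0
residue 1₄ = 1
residue 2₄ = 2
residue 3₄ = 3

residue-[]₄ : ∀ m → residue [ m ]₄ ≡ m % 4
residue-[]₄ 0 = refl
residue-[]₄ 1 = refl
residue-[]₄ 2 = refl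
residue-[]₄ 3 = refl
residue-[]₄ (suc (suc (suc (suc m)))) = begin
  residue (inc (inc (inc (inc [ m ]₄)))) ≡⟨ cong residue (inc⁴ [ m ]₄) ⟩
  residue [ m ]₄                         ≡⟨ residue-[]₄ m ⟩
  m % 4                                  ≡⟨ sym ([m+n]%n≡m%n m 4) ⟩
  (m + 4) % 4                            ≡⟨ cong (_% 4) (+-comm m 4) ⟩
  (4 + m) % 4                            ∎

[residue]₄ : ∀ x → [ residue x ]₄ ≡ x
[residue]₄ 0₄ = refl
[residue]₄ 1₄ = refl
[residue]₄ 2₄ = refl
[residue]₄ 3₄ = refl

[]₄-% : ∀ m → [ m ]₄ ≡ [ m % 4 ]₄
[]₄-% m = trans (sym ([residue]₄ [ m ]₄)) (cong [_]₄ (residue-[]₄ m))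

[]₄-from-%4 : ∀ k {r} → k % 4 ≡ r → [ k ]₄ ≡ [ r ]₄
[]₄-from-%4 k k%4≡r = trans ([]₄-% k) (cong [_]₄ k%4≡r)

%4-from-[]₄ : ∀ k {x} → [ k ]₄ ≡ x → k % 4 ≡ residue x
%4-from-[]₄ k k≡x = trans (sym (residue-[]₄ k)) (cong residue k≡x)

isOdd : ℤ₄ → Bool
isOdd 0₄ = false
isOdd 1₄ = true
isOdd 2₄ = false
isOdd 3₄ = true

twice : Bool → ℤ₄
twice false = 0₄
twice true = 2₄

isOdd-inc : ∀ x → isOdd (inc x) ≡ not (isOdd x)
isOdd-inc 0₄ = refl
isOdd-inc 1₄ = refl
isOdd-inc 2₄ = refl
isOdd-inc 3₄ = refl

isOdd-+₄ : ∀ x y → isOdd (x +₄ y) ≡ isOdd x xor isOdd y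
isOdd-+₄ 0₄ y = refl
isOdd-+₄ 1₄ y = isOdd-inc y
isOdd-+₄ 2₄ y = trans (isOdd-inc (inc y)) (trans (cong not (isOdd-inc y)) (not-involutive _))
isOdd-+₄ 3₄ y = trans (isOdd-inc (inc (inc y))) (cong not (isOdd-+₄ 2₄ y))

isOdd-twice : ∀ b → isOdd (twice b) ≡ false
isOdd-twice false = refl
isOdd-twice true = refl

odd-residue : ∀ {x} → isOdd x ≡ true → x ≢ 3₄ → x ≡ 1₄
odd-residue {1₄} _ _ = refl
odd-residue {3₄} _ x≢3 = ⊥-elim (x≢3 refl)

even-nonzero : ∀ {x} → isOdd x ≡ false → x ≢ 0₄ → x ≡ 2₄
even-nonzero {0₄} _ x≢0 = ⊥-elim (x≢0 refl)
even-nonzero {2₄} _ _ = refl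

inc²-twice-not : ∀ x b → inc (inc x) +₄ twice (not b) ≡ x +₄ twice b
inc²-twice-not 0₄ false = refl
inc²-twice-not 1₄ false = refl
inc²-twice-not 2₄ false = refl
inc²-twice-not 3₄ false = refl
inc²-twice-not 0₄ true = refl
inc²-twice-not 1₄ true = refl
inc²-twice-not 2₄ true = refl
inc²-twice-not 3₄ true = refl

infixl 6 _⊕_
_⊕_ : Subset n → Subset n → Subset n
_⊕_ = zipWith _xor_

⊕-assoc : (u v w : Subset n) → (u ⊕ v) ⊕ w ≡ u ⊕ (v ⊕ w)
⊕-assoc = zipWith-assoc xor-assoc

⊕-comm : (v w : Subset n) → v ⊕ w ≡ w ⊕ v
⊕-comm = zipWith-comm xor-comm

⊕-identityˡ : (v : Subset n) → ⊥ ⊕ v ≡ v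
⊕-identityˡ = zipWith-identityˡ xor-identityˡ

⊕-identityʳ : (v : Subset n) → v ⊕ ⊥ ≡ v
⊕-identityʳ = zipWith-identityʳ xor-identityʳ

⊕-self : (v : Subset n) → v ⊕ v ≡ ⊥
⊕-self [] = refl
⊕-self (b ∷ v) = cong₂ _∷_ (xor-same b) (⊕-self v)

⊕-cancel : (v w : Subset n) → v ⊕ w ≡ ⊥ → v ≡ w
⊕-cancel v w v⊕w≡⊥ = begin
  v             ≡⟨ sym (⊕-identityʳ v) ⟩
  v ⊕ ⊥         ≡⟨ cong (v ⊕_) (sym (⊕-self w)) ⟩
  v ⊕ (w ⊕ w)   ≡⟨ sym (⊕-assoc v w w) ⟩
  (v ⊕ w) ⊕ w   ≡⟨ cong (_⊕ w) v⊕w≡⊥ ⟩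
  ⊥ ⊕ w         ≡⟨ ⊕-identityˡ w ⟩
  w             ∎

⊕-swap : (u v w : Subset n) → u ⊕ (v ⊕ w) ≡ v ⊕ (u ⊕ w)
⊕-swap u v w = begin
  u ⊕ (v ⊕ w)   ≡⟨ sym (⊕-assoc u v w) ⟩
  (u ⊕ v) ⊕ w   ≡⟨ cong (_⊕ w) (⊕-comm u v) ⟩
  (v ⊕ u) ⊕ w   ≡⟨ ⊕-assoc v u w ⟩
  v ⊕ (u ⊕ w)   ∎

⊕-translate : (t v w : Subset n) → (t ⊕ v) ⊕ (t ⊕ w) ≡ v ⊕ w
⊕-translate t v w = begin
  (t ⊕ v) ⊕ (t ⊕ w)   ≡⟨ ⊕-assoc t v (t ⊕ w) ⟩
  t ⊕ (v ⊕ (t ⊕ w))   ≡⟨ cong (t ⊕_) (⊕-swap v t w) ⟩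
  t ⊕ (t ⊕ (v ⊕ w))   ≡⟨ sym (⊕-assoc t t (v ⊕ w)) ⟩
  (t ⊕ t) ⊕ (v ⊕ w)   ≡⟨ cong (_⊕ (v ⊕ w)) (⊕-self t) ⟩
  ⊥ ⊕ (v ⊕ w)         ≡⟨ ⊕-identityˡ (v ⊕ w) ⟩
  v ⊕ w               ∎

wt : Subset n → ℤ₄
wt v = [ ∣ v ∣ ]₄

parity : Subset n → Bool
parity v = isOdd (wt v)

⟨_,_⟩ : Subset n → Subset n → Bool
⟨ v , w ⟩ = parity (v ∩ w)

wt-⊥ : wt (⊥ {n}) ≡ 0₄
wt-⊥ {n} = cong [_]₄ (∣⊥∣≡0 n)

wt-⊤ : wt (⊤ {n}) ≡ [ n ]₄
wt-⊤ {n} = cong [_]₄ (∣⊤∣≡n n)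

-- The key identity |v ⊕ w| = |v| + |w| - 2|v ∩ w|, read modulo 4
-- (where -2k ≡ 2k and 2k only depends on the parity of k).
wt-⊕ : (v w : Subset n) → wt (v ⊕ w) ≡ wt v +₄ wt w +₄ twice ⟨ v , w ⟩
wt-⊕ [] [] = refl
wt-⊕ (false ∷ v) (false ∷ w) = wt-⊕ v w
wt-⊕ (true ∷ v) (false ∷ w) = begin
  inc (wt (v ⊕ w))                ≡⟨ cong inc (wt-⊕ v w) ⟩
  inc (wt v +₄ wt w +₄ twice b)   ≡⟨ sym (+₄-incˡ (wt v +₄ wt w) (twice b)) ⟩
  inc (wt v +₄ wt w) +₄ twice b   ≡⟨ cong (_+₄ twice b) (sym (+₄-incˡ (wt v) (wt w))) ⟩
  inc (wt v) +₄ wt w +₄ twice b   ∎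
  where b = ⟨ v , w ⟩
wt-⊕ (false ∷ v) (true ∷ w) = begin
  inc (wt (v ⊕ w))                ≡⟨ cong inc (wt-⊕ v w) ⟩
  inc (wt v +₄ wt w +₄ twice b)   ≡⟨ sym (+₄-incˡ (wt v +₄ wt w) (twice b)) ⟩
  inc (wt v +₄ wt w) +₄ twice b   ≡⟨ cong (_+₄ twice b) (sym (+₄-incʳ (wt v) (wt w))) ⟩
  wt v +₄ inc (wt w) +₄ twice b   ∎
  where b = ⟨ v , w ⟩
wt-⊕ (true ∷ v) (true ∷ w) = begin
  wt (v ⊕ w)                                 ≡⟨ wt-⊕ v w ⟩
  wt v +₄ wt w +₄ twice b                    ≡⟨ sym (inc²-twice-not (wt v +₄ wt w) b) ⟩
  inc (inc (wt v +₄ wt w)) +₄ twice (not b)  ≡⟨ cong₂ _+₄_ inc-both (cong twice (sym (isOdd-inc (wt (v ∩ w))))) ⟩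
  inc (wt v) +₄ inc (wt w) +₄ twice ⟨ true ∷ v , true ∷ w ⟩ ∎
  where
  b = ⟨ v , w ⟩
  inc-both : inc (inc (wt v +₄ wt w)) ≡ inc (wt v) +₄ inc (wt w)
  inc-both = sym (trans (+₄-incˡ (wt v) (inc (wt w))) (cong inc (+₄-incʳ (wt v) (wt w))))

parity-⊕ : (v w : Subset n) → parity (v ⊕ w) ≡ parity v xor parity w
parity-⊕ v w = begin
  isOdd (wt (v ⊕ w))                                        ≡⟨ cong isOdd (wt-⊕ v w) ⟩
  isOdd (wt v +₄ wt w +₄ twice ⟨ v , w ⟩)                    ≡⟨ isOdd-+₄ (wt v +₄ wt w) _ ⟩
  isOdd (wt v +₄ wt w) xor isOdd (twice ⟨ v , w ⟩)           ≡⟨ cong₂ _xor_ (isOdd-+₄ (wt v) (wt w)) (isOdd-twice _) ⟩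
  (parity v xor parity w) xor false                          ≡⟨ xor-identityʳ _ ⟩
  parity v xor parity w                                      ∎

⟨⟩-comm : (v w : Subset n) → ⟨ v , w ⟩ ≡ ⟨ w , v ⟩
⟨⟩-comm v w = cong parity (∩-comm v w)

⟨⟩-self : (v : Subset n) → ⟨ v , v ⟩ ≡ parity v
⟨⟩-self v = cong parity (∩-idem v)

⟨⟩-⊤ : (v : Subset n) → ⟨ v , ⊤ ⟩ ≡ parity v
⟨⟩-⊤ v = cong parity (∩-identityʳ v)

⟨⟩-⊥ : (w : Subset n) → ⟨ ⊥ , w ⟩ ≡ false
⟨⟩-⊥ {n} w = cong isOdd (trans (cong wt (∩-zeroˡ w)) (wt-⊥ {n}))

⟨⟩-⊕ˡ : (u v w : Subset n) → ⟨ u ⊕ v , w ⟩ ≡ ⟨ u , w ⟩ xor ⟨ v , w ⟩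
⟨⟩-⊕ˡ u v w = trans (cong parity (zipWith-distribʳ ∧-distribʳ-xor w u v)) (parity-⊕ (u ∩ w) (v ∩ w))

-- Linear combinations, independence and dimension counting.

⨁ : (L : List (Subset n)) → Subset (length L) → Subset n
⨁ [] [] = ⊥
⨁ (v ∷ L) (true ∷ S) = v ⊕ ⨁ L S
⨁ (v ∷ L) (false ∷ S) = ⨁ L S

⨁-⊕ : (L : List (Subset n)) (S S′ : Subset (length L)) → ⨁ L (S ⊕ S′) ≡ ⨁ L S ⊕ ⨁ L S′
⨁-⊕ [] [] [] = sym (⊕-self ⊥)
⨁-⊕ (v ∷ L) (false ∷ S) (false ∷ S′) = ⨁-⊕ L S S′
⨁-⊕ (v ∷ L) (true ∷ S) (false ∷ S′) =
  trans (cong (v ⊕_) (⨁-⊕ L S S′)) (sym (⊕-assoc v (⨁ L S) (⨁ L S′)))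
⨁-⊕ (v ∷ L) (false ∷ S) (true ∷ S′) =
  trans (cong (v ⊕_) (⨁-⊕ L S S′)) (⊕-swap v (⨁ L S) (⨁ L S′))
⨁-⊕ (v ∷ L) (true ∷ S) (true ∷ S′) =
  trans (⨁-⊕ L S S′) (sym (⊕-translate v (⨁ L S) (⨁ L S′)))

Independent : List (Subset n) → Set
Independent L = ∀ S → ⨁ L S ≡ ⊥ → S ≡ ⊥

⨁-injective : (L : List (Subset n)) → Independent L →
  ∀ {S S′} → ⨁ L S ≡ ⨁ L S′ → S ≡ S′
⨁-injective L ind {S} {S′} eq = ⊕-cancel S S′ (ind (S ⊕ S′) (begin
  ⨁ L (S ⊕ S′)          ≡⟨ ⨁-⊕ L S S′ ⟩
  ⨁ L S ⊕ ⨁ L S′        ≡⟨ cong (_⊕ ⨁ L S′) eq ⟩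
  ⨁ L S′ ⊕ ⨁ L S′       ≡⟨ ⊕-self (⨁ L S′) ⟩
  ⊥                     ∎))

module Binary where
  open Inverse 2↔Bool using (to; from; strictlyInverseˡ; strictlyInverseʳ)

  toFin : Subset n → Fin (2 ^ n)
  toFin v = funToFin (λ i → from (lookup v i))

  fromFin : Fin (2 ^ n) → Subset n
  fromFin j = Vec.tabulate (λ i → to (finToFun j i))

  funToFin-cong : {f g : Fin n → Fin 2} → f ≗ g → funToFin f ≡ funToFin g
  funToFin-cong {zero} f≗g = refl
  funToFin-cong {suc n} f≗g = cong₂ combine (f≗g zero) (funToFin-cong (λ i → f≗g (suc i)))

  fromFin-toFin : (v : Subset n) → fromFin (toFin v) ≡ v
  fromFin-toFin v = trans
    (tabulate-cong (λ i → trans (cong to (finToFun-funToFin _ i)) (strictlyInverseˡ (lookup v i))))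
    (tabulate∘lookup v)

  toFin-fromFin : (j : Fin (2 ^ n)) → toFin {n} (fromFin j) ≡ j
  toFin-fromFin {n} j = trans
    (funToFin-cong {n} (λ i → trans (cong from (lookup∘tabulate (λ i → to (finToFun {2} {n} j i)) i))
                                    (strictlyInverseʳ (finToFun j i))))
    (funToFin-finToFin {n} j)

  toFin-injective : {v w : Subset n} → toFin v ≡ toFin w → v ≡ w
  toFin-injective {v = v} {w} eq =
    trans (sym (fromFin-toFin v)) (trans (cong fromFin eq) (fromFin-toFin w))

  fromFin-injective : {i j : Fin (2 ^ n)} → fromFin {n} i ≡ fromFin j → i ≡ j
  fromFin-injective {n} {i} {j} eq =
    trans (sym (toFin-fromFin {n} i)) (trans (cong toFin eq) (toFin-fromFin {n} j))

open Binary using (toFin; fromFin; toFin-injective; fromFin-injective)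

-- Counting: an injection from Subset k into Subset n gives 2^k ≤ 2^n, so k ≤ n.
injection⇒≤ : (f : Subset k → Subset n) → (∀ {S S′} → f S ≡ f S′ → S ≡ S′) → k ≤ n
injection⇒≤ {k} {n} f f-inj = ≮⇒≥ (λ n<k → <⇒≱ (^-monoʳ-< 2 (s≤s (s≤s z≤n)) n<k) 2^k≤2^n)
  where
  2^k≤2^n : 2 ^ k ≤ 2 ^ n
  2^k≤2^n = injective⇒≤ {f = λ j → toFin (f (fromFin j))}
    (λ eq → fromFin-injective {k} (f-inj (toFin-injective eq)))

independent⇒length≤ : (L : List (Subset n)) → Independent L → length L ≤ n
independent⇒length≤ L ind = injection⇒≤ (⨁ L) (⨁-injective L ind)

Even : Subset n → Set
Even v = parity v ≡ false

⨁-even : (L : List (Subset n)) → All Even L → ∀ S → Even (⨁ L S)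
⨁-even {n} [] [] [] = cong isOdd (wt-⊥ {n})
⨁-even (v ∷ L) (ev ∷ evs) (false ∷ S) = ⨁-even L evs S
⨁-even (v ∷ L) (ev ∷ evs) (true ∷ S) =
  trans (parity-⊕ v (⨁ L S)) (cong₂ _xor_ ev (⨁-even L evs S))

tail-injective : (x y : Subset (suc n)) → parity x ≡ parity y → Vec.tail x ≡ Vec.tail y → x ≡ y
tail-injective (false ∷ t) (false ∷ .t) _ refl = refl
tail-injective (true ∷ t) (true ∷ .t) _ refl = refl
tail-injective (false ∷ t) (true ∷ .t) p refl = ⊥-elim (not-¬ refl (trans p (isOdd-inc (wt t))))
tail-injective (true ∷ t) (false ∷ .t) p refl = ⊥-elim (not-¬ refl (trans (sym p) (isOdd-inc (wt t))))

-- The even vectors form a subspace of dimension n in GF(2)^(n+1).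
even-independent⇒length≤ : (L : List (Subset (suc n))) → All Even L → Independent L → length L ≤ n
even-independent⇒length≤ L evs ind = injection⇒≤ (λ S → Vec.tail (⨁ L S))
  (λ {S} {S′} eq → ⨁-injective L ind
    (tail-injective _ _ (trans (⨁-even L evs S) (sym (⨁-even L evs S′))) eq))

-- Gram matrices.

gram : (L : List (Subset n)) → Subset n → Subset (length L)
gram [] x = []
gram (v ∷ L) x = ⟨ x , v ⟩ ∷ gram L x

gram-⊕ : (L : List (Subset n)) (x y : Subset n) → gram L (x ⊕ y) ≡ gram L x ⊕ gram L y
gram-⊕ [] x y = refl
gram-⊕ (v ∷ L) x y = cong₂ _∷_ (⟨⟩-⊕ˡ x y v) (gram-⊕ L x y)

gram-⊥ : (L : List (Subset n)) → gram L ⊥ ≡ ⊥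
gram-⊥ [] = refl
gram-⊥ (v ∷ L) = cong₂ _∷_ (⟨⟩-⊥ v) (gram-⊥ L)

gram-constant : (L : List (Subset n)) (x : Subset n) {b : Bool} →
  All (λ w → ⟨ x , w ⟩ ≡ b) L → gram L x ≡ replicate _ b
gram-constant [] x [] = refl
gram-constant (w ∷ L) x (e ∷ es) = cong₂ _∷_ e (gram-constant L x es)

xor-∧-not : ∀ b p → b xor (b ∧ p) ≡ b ∧ not p
xor-∧-not false p = refl
xor-∧-not true p = refl

⟨⨁,⟩ : (L : List (Subset n)) (v : Subset n) {b : Bool} →
  All (λ w → ⟨ v , w ⟩ ≡ b) L → ∀ S → ⟨ ⨁ L S , v ⟩ ≡ b ∧ parity S
⟨⨁,⟩ [] v {b} [] [] = trans (⟨⟩-⊥ v) (sym (∧-zeroʳ b))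
⟨⨁,⟩ (w ∷ L) v (_ ∷ es) (false ∷ S) = ⟨⨁,⟩ L v es S
⟨⨁,⟩ (w ∷ L) v {b} (e ∷ es) (true ∷ S) = begin
  ⟨ w ⊕ ⨁ L S , v ⟩              ≡⟨ ⟨⟩-⊕ˡ w (⨁ L S) v ⟩
  ⟨ w , v ⟩ xor ⟨ ⨁ L S , v ⟩     ≡⟨ cong₂ _xor_ (trans (⟨⟩-comm w v) e) (⟨⨁,⟩ L v es S) ⟩
  b xor (b ∧ parity S)           ≡⟨ xor-∧-not b (parity S) ⟩
  b ∧ not (parity S)             ≡⟨ cong (b ∧_) (sym (isOdd-inc (wt S))) ⟩
  b ∧ parity (true ∷ S)          ∎

-- A "uniform" Gram matrix G = b·J + (a ⊕ b)·I (diagonal a, off-diagonal b)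
-- acts on coefficient vectors S as S ↦ b·|S|·𝟙 + (a ⊕ b)·S.
gram-⨁ : (L : List (Subset n)) {a b : Bool} →
  All (λ v → ⟨ v , v ⟩ ≡ a) L → AllPairs (λ v w → ⟨ v , w ⟩ ≡ b) L →
  ∀ S → gram L (⨁ L S) ≡ replicate _ (b ∧ parity S) ⊕ Vec.map ((a xor b) ∧_) S
gram-⨁ [] [] [] [] = refl
gram-⨁ (v ∷ L) {a} {b} (_ ∷ diag) (row ∷ rows) (false ∷ S) =
  cong₂ _∷_ head (gram-⨁ L diag rows S)
  where
  head : ⟨ ⨁ L S , v ⟩ ≡ (b ∧ parity S) xor ((a xor b) ∧ false)
  head = trans (⟨⨁,⟩ L v row S)
    (sym (trans (cong ((b ∧ parity S) xor_) (∧-zeroʳ (a xor b))) (xor-identityʳ _)))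
gram-⨁ (v ∷ L) {a} {b} (vv ∷ diag) (row ∷ rows) (true ∷ S) = cong₂ _∷_ head tail
  where
  p = parity S
  M = Vec.map ((a xor b) ∧_) S
  flip-bit : ∀ a b p → a xor (b ∧ p) ≡ (b ∧ not p) xor ((a xor b) ∧ true)
  flip-bit false false p = refl
  flip-bit false true false = refl
  flip-bit false true true = refl
  flip-bit true false p = refl
  flip-bit true true false = refl
  flip-bit true true true = refl
  head : ⟨ v ⊕ ⨁ L S , v ⟩ ≡ (b ∧ parity (true ∷ S)) xor ((a xor b) ∧ true)
  head = begin
    ⟨ v ⊕ ⨁ L S , v ⟩                     ≡⟨ ⟨⟩-⊕ˡ v (⨁ L S) v ⟩
    ⟨ v , v ⟩ xor ⟨ ⨁ L S , v ⟩            ≡⟨ cong₂ _xor_ vv (⟨⨁,⟩ L v row S) ⟩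
    a xor (b ∧ p)                         ≡⟨ flip-bit a b p ⟩
    (b ∧ not p) xor ((a xor b) ∧ true)    ≡⟨ cong (λ q → (b ∧ q) xor ((a xor b) ∧ true)) (sym (isOdd-inc (wt S))) ⟩
    (b ∧ parity (true ∷ S)) xor ((a xor b) ∧ true) ∎
  tail : gram L (v ⊕ ⨁ L S) ≡ replicate _ (b ∧ parity (true ∷ S)) ⊕ M
  tail = begin
    gram L (v ⊕ ⨁ L S)                                ≡⟨ gram-⊕ L v (⨁ L S) ⟩
    gram L v ⊕ gram L (⨁ L S)                         ≡⟨ cong₂ _⊕_ (gram-constant L v row) (gram-⨁ L diag rows S) ⟩
    replicate _ b ⊕ (replicate _ (b ∧ p) ⊕ M)         ≡⟨ sym (⊕-assoc _ _ M) ⟩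
    (replicate _ b ⊕ replicate _ (b ∧ p)) ⊕ M         ≡⟨ cong (_⊕ M) (zipWith-replicate _xor_ b (b ∧ p)) ⟩
    replicate _ (b xor (b ∧ p)) ⊕ M                   ≡⟨ cong (λ q → replicate _ q ⊕ M) (xor-∧-not b p) ⟩
    replicate _ (b ∧ not p) ⊕ M                       ≡⟨ cong (λ q → replicate _ (b ∧ q) ⊕ M) (sym (isOdd-inc (wt S))) ⟩
    replicate _ (b ∧ parity (true ∷ S)) ⊕ M           ∎

gram-orthonormal : (L : List (Subset n)) →
  All (λ v → ⟨ v , v ⟩ ≡ true) L → AllPairs (λ v w → ⟨ v , w ⟩ ≡ false) L →
  ∀ S → gram L (⨁ L S) ≡ S
gram-orthonormal L diag rows S =
  trans (gram-⨁ L diag rows S) (trans (⊕-identityˡ (Vec.map (true ∧_) S)) (map-id S))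

orthonormal⇒independent : (L : List (Subset n)) →
  All (λ v → ⟨ v , v ⟩ ≡ true) L → AllPairs (λ v w → ⟨ v , w ⟩ ≡ false) L →
  Independent L
orthonormal⇒independent L diag rows S ⨁≡⊥ =
  trans (sym (gram-orthonormal L diag rows S)) (trans (cong (gram L) ⨁≡⊥) (gram-⊥ L))

-- Gram matrix J + I is invertible over GF(2) when its size is even:
-- (J + I) S = 0 forces S ∈ {0, 𝟙}, and 𝟙 is excluded because J𝟙 = 0.
J+I⇒independent : (L : List (Subset n)) →
  All (λ v → ⟨ v , v ⟩ ≡ false) L → AllPairs (λ v w → ⟨ v , w ⟩ ≡ true) L →
  isOdd [ length L ]₄ ≡ false → Independent L
J+I⇒independent L diag rows even S ⨁≡⊥ = constant⇒⊥ S S-constant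
  where
  S-constant : replicate _ (parity S) ≡ S
  S-constant = ⊕-cancel _ S (begin
    replicate _ (parity S) ⊕ S                ≡⟨ cong (replicate _ (parity S) ⊕_) (sym (map-id S)) ⟩
    replicate _ (parity S) ⊕ Vec.map (true ∧_) S  ≡⟨ sym (gram-⨁ L diag rows S) ⟩
    gram L (⨁ L S)                            ≡⟨ cong (gram L) ⨁≡⊥ ⟩
    gram L ⊥                                  ≡⟨ gram-⊥ L ⟩
    ⊥                                         ∎)
  constant⇒⊥ : (S : Subset (length L)) → replicate _ (parity S) ≡ S → S ≡ ⊥
  constant⇒⊥ S eq with parity S in p
  ... | false = sym eq
  ... | true = ⊥-elim (not-¬ refl (begin
    true                       ≡⟨ sym p ⟩
    parity S                   ≡⟨ cong parity (sym eq) ⟩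
    isOdd (wt (⊤ {length L}))  ≡⟨ cong isOdd (wt-⊤ {length L}) ⟩
    isOdd [ length L ]₄        ≡⟨ even ⟩
    false                      ∎))

-- Orthogonal families of vectors of weight ≡ 3 (mod 4).

Σ-wt : List (Subset n) → ℤ₄
Σ-wt [] = 0₄
Σ-wt (u ∷ U) = wt u +₄ Σ-wt U

wt-⨁-orthogonal : (U : List (Subset n)) → AllPairs (λ u w → ⟨ u , w ⟩ ≡ false) U →
  wt (⨁ U ⊤) ≡ Σ-wt U
wt-⨁-orthogonal {n} [] [] = wt-⊥ {n}
wt-⨁-orthogonal (u ∷ U) (row ∷ rows) = begin
  wt (u ⊕ ⨁ U ⊤)                              ≡⟨ wt-⊕ u (⨁ U ⊤) ⟩
  wt u +₄ wt (⨁ U ⊤) +₄ twice ⟨ u , ⨁ U ⊤ ⟩  ≡⟨ cong (λ b → wt u +₄ wt (⨁ U ⊤) +₄ twice b)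
                                                   (trans (⟨⟩-comm u (⨁ U ⊤)) (⟨⨁,⟩ U u row ⊤)) ⟩
  wt u +₄ wt (⨁ U ⊤) +₄ 0₄                     ≡⟨ +₄-identityʳ _ ⟩
  wt u +₄ wt (⨁ U ⊤)                           ≡⟨ cong (wt u +₄_) (wt-⨁-orthogonal U rows) ⟩
  wt u +₄ Σ-wt U                               ∎

Σ-wt-threes : (U : List (Subset n)) → All (λ u → wt u ≡ 3₄) U → [ length U ]₄ ≡ 1₄ → Σ-wt U ≡ 3₄
Σ-wt-threes [] [] ()
Σ-wt-threes (a ∷ []) (a₃ ∷ []) _ = trans (+₄-identityʳ (wt a)) a₃
Σ-wt-threes (a ∷ b ∷ []) _ ()
Σ-wt-threes (a ∷ b ∷ c ∷ []) _ ()
Σ-wt-threes (a ∷ b ∷ c ∷ d ∷ U) (a₃ ∷ b₃ ∷ c₃ ∷ d₃ ∷ U₃) len = begin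
  wt a +₄ (wt b +₄ (wt c +₄ (wt d +₄ Σ-wt U)))  ≡⟨ cong₂ (λ x y → x +₄ (y +₄ (wt c +₄ (wt d +₄ Σ-wt U)))) a₃ b₃ ⟩
  3₄ +₄ (3₄ +₄ (wt c +₄ (wt d +₄ Σ-wt U)))      ≡⟨ cong₂ (λ x y → 3₄ +₄ (3₄ +₄ (x +₄ (y +₄ Σ-wt U)))) c₃ d₃ ⟩
  3₄ +₄ (3₄ +₄ (3₄ +₄ (3₄ +₄ Σ-wt U)))          ≡⟨ four-threes (Σ-wt U) ⟩
  Σ-wt U                                        ≡⟨ Σ-wt-threes U U₃ (trans (sym (inc⁴ _)) len) ⟩
  3₄                                            ∎
  where
  four-threes : ∀ x → 3₄ +₄ (3₄ +₄ (3₄ +₄ (3₄ +₄ x))) ≡ x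
  four-threes 0₄ = refl
  four-threes 1₄ = refl
  four-threes 2₄ = refl
  four-threes 3₄ = refl

-- Let n ≡ 1 (mod 4). An orthogonal family U of k ≡ 1 (mod 4) vectors of
-- weight ≡ 3 (mod 4) in GF(2)ⁿ has k < n: together with 𝟙 it is independent,
-- since 𝟙 = ⨁ U S would force S = 𝟙 and then |𝟙| ≡ 3k ≡ 3, while |𝟙| = n ≡ 1.
orthogonal-threes-bound : [ n ]₄ ≡ 1₄ → (U : List (Subset n)) → [ length U ]₄ ≡ 1₄ →
  All (λ u → wt u ≡ 3₄) U → AllPairs (λ u w → ⟨ u , w ⟩ ≡ false) U → length U < n
orthogonal-threes-bound {n} n≡1 U k≡1 U₃ rows = independent⇒length≤ (⊤ ∷ U) independent
  where
  normalized : All (λ u → ⟨ u , u ⟩ ≡ true) U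
  normalized = All.map (λ {u} u₃ → trans (⟨⟩-self u) (cong isOdd u₃)) U₃
  ⟨⊤,U⟩ : All (λ u → ⟨ ⊤ , u ⟩ ≡ true) U
  ⟨⊤,U⟩ = All.map (λ {u} u₃ → trans (⟨⟩-comm ⊤ u) (trans (⟨⟩-⊤ u) (cong isOdd u₃))) U₃
  independent : Independent (⊤ ∷ U)
  independent (false ∷ S) ⨁≡⊥ = cong (false ∷_) (orthonormal⇒independent U normalized rows S ⨁≡⊥)
  independent (true ∷ S) ⊤⊕⨁≡⊥ = ⊥-elim (1₄≢3₄ (begin
    1₄              ≡⟨ sym n≡1 ⟩
    [ n ]₄          ≡⟨ sym (wt-⊤ {n}) ⟩
    wt (⊤ {n})      ≡⟨ cong wt ⊤≡⨁ ⟩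
    wt (⨁ U S)      ≡⟨ cong (λ T → wt (⨁ U T)) S≡⊤ ⟩
    wt (⨁ U ⊤)      ≡⟨ wt-⨁-orthogonal U rows ⟩
    Σ-wt U          ≡⟨ Σ-wt-threes U U₃ k≡1 ⟩
    3₄              ∎))
    where
    ⊤≡⨁ : ⊤ ≡ ⨁ U S
    ⊤≡⨁ = ⊕-cancel ⊤ (⨁ U S) ⊤⊕⨁≡⊥
    S≡⊤ : S ≡ ⊤
    S≡⊤ = trans (sym (gram-orthonormal U normalized rows S))
                (trans (cong (gram U) (sym ⊤≡⨁)) (gram-constant U ⊤ ⟨⊤,U⟩))
    1₄≢3₄ : 1₄ ≢ 3₄
    1₄≢3₄ ()

-- Two-codes: vectors of weight ≡ 2 with pairwise distances ≡ 2 (mod 4).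

allPairs-refine : {A : Set} {P : A → Set} {R S : A → A → Set} {xs : List A} →
  (∀ {x y} → P x → P y → R x y → S x y) → All P xs → AllPairs R xs → AllPairs S xs
allPairs-refine f [] [] = []
allPairs-refine {P = P} {R} {S} f (px ∷ pxs) (rx ∷ rxs) = row px pxs rx ∷ allPairs-refine f pxs rxs
  where
  row : ∀ {x ys} → P x → All P ys → All (R x) ys → All (S x) ys
  row px [] [] = []
  row px (py ∷ pys) (r ∷ rs) = f px py r ∷ row px pys rs

Weight₂ : Subset n → Set
Weight₂ v = wt v ≡ 2₄

Distance₂ : Subset n → Subset n → Set
Distance₂ v w = Weight₂ (v ⊕ w)

weight₂⇒even : {v : Subset n} → Weight₂ v → Even v
weight₂⇒even w₂ = cong isOdd w₂

weight₂⇒⟨⟩-self : {v : Subset n} → Weight₂ v → ⟨ v , v ⟩ ≡ false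
weight₂⇒⟨⟩-self {v = v} w₂ = trans (⟨⟩-self v) (weight₂⇒even {v = v} w₂)

distance₂⇒⟨⟩ : {v w : Subset n} → Weight₂ v → Weight₂ w → Distance₂ v w → ⟨ v , w ⟩ ≡ true
distance₂⇒⟨⟩ {v = v} {w} v₂ w₂ vw₂ = twice≡2₄ ⟨ v , w ⟩ (begin
  twice ⟨ v , w ⟩                      ≡⟨⟩
  2₄ +₄ 2₄ +₄ twice ⟨ v , w ⟩          ≡⟨ cong₂ (λ x y → x +₄ y +₄ twice ⟨ v , w ⟩) (sym v₂) (sym w₂) ⟩
  wt v +₄ wt w +₄ twice ⟨ v , w ⟩      ≡⟨ sym (wt-⊕ v w) ⟩
  wt (v ⊕ w)                           ≡⟨ vw₂ ⟩
  2₄                                   ∎)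
  where
  twice≡2₄ : ∀ b → twice b ≡ 2₄ → b ≡ true
  twice≡2₄ true _ = refl

two-code-gram : {L : List (Subset n)} → All Weight₂ L → AllPairs Distance₂ L →
  AllPairs (λ v w → ⟨ v , w ⟩ ≡ true) L
two-code-gram = allPairs-refine (λ {v} {w} → distance₂⇒⟨⟩ {v = v} {w})

two-code-even-length : (L : List (Subset (suc m))) → All Weight₂ L → AllPairs Distance₂ L →
  isOdd [ length L ]₄ ≡ false → length L ≤ m
two-code-even-length L w₂ d₂ even = even-independent⇒length≤ L
  (All.map (λ {v} → weight₂⇒even {v = v}) w₂)
  (J+I⇒independent L (All.map (λ {v} → weight₂⇒⟨⟩-self {v = v}) w₂) (two-code-gram w₂ d₂) even)

-- Dropping one member if necessary, every two-code has at most n members.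
two-code-bound : (L : List (Subset (suc m))) → All Weight₂ L → AllPairs Distance₂ L →
  length L ≤ suc m
two-code-bound [] _ _ = z≤n
two-code-bound (v ∷ L) (v₂ ∷ w₂) (row ∷ d₂) with isOdd [ length L ]₄ in parity-L
... | false = s≤s (two-code-even-length L w₂ d₂ parity-L)
... | true = m≤n⇒m≤1+n (two-code-even-length (v ∷ L) (v₂ ∷ w₂) (row ∷ d₂)
                         (trans (isOdd-inc [ length L ]₄) (cong not parity-L)))

-- For n ≡ 1 (mod 4) no two-code has n members: the complements v ⊕ 𝟙 of its
-- members would be an orthogonal family of n vectors of weight ≡ 3.
two-code-not-full : [ suc m ]₄ ≡ 1₄ → (L : List (Subset (suc m))) →
  All Weight₂ L → AllPairs Distance₂ L → length L ≢ suc m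
two-code-not-full {m} n≡1 L w₂ d₂ length≡n =
  <-irrefl refl (subst (_< suc m) length-U≡n
    (orthogonal-threes-bound n≡1 U (trans (cong [_]₄ length-U≡n) n≡1)
      (All-map⁺ (All.map (λ {v} → complement-weight {v}) w₂))
      (AllPairs-map⁺ (allPairs-refine (λ {v} {w} → complement-orthogonal {v} {w})
                                      w₂ (two-code-gram w₂ d₂)))))
  where
  U = map (_⊕ ⊤) L
  length-U≡n : length U ≡ suc m
  length-U≡n = trans (length-map (_⊕ ⊤) L) length≡n
  complement-weight : {v : Subset (suc m)} → Weight₂ v → wt (v ⊕ ⊤) ≡ 3₄
  complement-weight {v} v₂ = trans (wt-⊕ v ⊤)
    (cong₂ (λ x b → x +₄ twice b) (cong₂ _+₄_ v₂ (trans (wt-⊤ {suc m}) n≡1))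
                                   (trans (⟨⟩-⊤ v) (weight₂⇒even {v = v} v₂)))
  ⟨⊤,complement⟩ : {w : Subset (suc m)} → Weight₂ w → ⟨ ⊤ , w ⊕ ⊤ ⟩ ≡ true
  ⟨⊤,complement⟩ {w} w₂ =
    trans (⟨⟩-comm ⊤ (w ⊕ ⊤)) (trans (⟨⟩-⊤ (w ⊕ ⊤)) (cong isOdd (complement-weight {w} w₂)))
  complement-orthogonal : {v w : Subset (suc m)} → Weight₂ v → Weight₂ w → ⟨ v , w ⟩ ≡ true →
    ⟨ v ⊕ ⊤ , w ⊕ ⊤ ⟩ ≡ false
  complement-orthogonal {v} {w} v₂ w₂ ⟨v,w⟩ = begin
    ⟨ v ⊕ ⊤ , w ⊕ ⊤ ⟩                         ≡⟨ ⟨⟩-⊕ˡ v ⊤ (w ⊕ ⊤) ⟩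
    ⟨ v , w ⊕ ⊤ ⟩ xor ⟨ ⊤ , w ⊕ ⊤ ⟩           ≡⟨ cong₂ _xor_ ⟨v,w⊕⊤⟩ (⟨⊤,complement⟩ {w} w₂) ⟩
    true xor true                             ∎
    where
    ⟨v,w⊕⊤⟩ : ⟨ v , w ⊕ ⊤ ⟩ ≡ true
    ⟨v,w⊕⊤⟩ = begin
      ⟨ v , w ⊕ ⊤ ⟩               ≡⟨ ⟨⟩-comm v (w ⊕ ⊤) ⟩
      ⟨ w ⊕ ⊤ , v ⟩               ≡⟨ ⟨⟩-⊕ˡ w ⊤ v ⟩
      ⟨ w , v ⟩ xor ⟨ ⊤ , v ⟩     ≡⟨ cong₂ _xor_ (trans (⟨⟩-comm w v) ⟨v,w⟩)
                                         (trans (⟨⟩-comm ⊤ v) (trans (⟨⟩-⊤ v) (weight₂⇒even {v = v} v₂))) ⟩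
      true xor false              ∎

two-code-sharp : [ suc m ]₄ ≢ 3₄ → (L : List (Subset (suc m))) →
  All Weight₂ L → AllPairs Distance₂ L → length L ≤ m
two-code-sharp {m} n≢3 L w₂ d₂ with length L ≟ suc m
... | no length≢n = ≤-pred (≤∧≢⇒< (two-code-bound L w₂ d₂) length≢n)
... | yes length≡n with isOdd [ suc m ]₄ in parity-n
...   | false = ⊥-elim (1+n≰n (subst (_≤ m) length≡n
                  (two-code-even-length L w₂ d₂ (trans (cong (λ k → isOdd [ k ]₄) length≡n) parity-n))))
...   | true = ⊥-elim (two-code-not-full (odd-residue parity-n n≢3) L w₂ d₂ length≡n)

symmetric-difference : (F G : Subset n) → (F ─ G) ∪ (G ─ F) ≡ F ⊕ G
symmetric-difference [] [] = refl
symmetric-difference (true ∷ F) (true ∷ G) = cong (false ∷_) (symmetric-difference F G)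
symmetric-difference (true ∷ F) (false ∷ G) = cong (true ∷_) (symmetric-difference F G)
symmetric-difference (false ∷ F) (true ∷ G) = cong (true ∷_) (symmetric-difference F G)
symmetric-difference (false ∷ F) (false ∷ G) = cong (false ∷_) (symmetric-difference F G)

4∣⇒[]₄≡0 : ∀ k → 4 ∣ k → [ k ]₄ ≡ 0₄
4∣⇒[]₄≡0 k 4∣k = []₄-from-%4 k (n∣m⇒m%n≡0 k 4 4∣k)

[]₄≡0⇒4∣ : ∀ k → [ k ]₄ ≡ 0₄ → 4 ∣ k
[]₄≡0⇒4∣ k k≡0 = m%n≡0⇒n∣m k 4 (%4-from-[]₄ k k≡0)

Apart : Subset n → Subset n → Set
Apart F G = wt (F ⊕ G) ≢ 0₄

¬4∣d⇒apart : (F G : Subset n) → ¬ (4 ∣ d F G) → Apart F G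
¬4∣d⇒apart F G ¬4∣d wt≡0 =
  ¬4∣d ([]₄≡0⇒4∣ (d F G) (trans (cong (λ X → [ ∣ X ∣ ]₄) (symmetric-difference F G)) wt≡0))

apart⇒¬4∣d : (F G : Subset n) → Apart F G → ¬ (4 ∣ d F G)
apart⇒¬4∣d F G apart 4∣d =
  apart (trans (cong (λ X → [ ∣ X ∣ ]₄) (sym (symmetric-difference F G))) (4∣⇒[]₄≡0 (d F G) 4∣d))

-- The largest size of a family of subsets of one parity whose pairwise
-- distances are all ≡ 2 (mod 4); the theorem's bound is twice this.
classBound : ℕ → ℕ
classBound n with n % 4 ≟ 3
... | yes _ = suc n
... | no _ = n

bound≡2×classBound : ∀ n → bound n ≡ classBound n + classBound n
bound≡2×classBound n with n % 4 ≟ 3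
... | yes n%4≡3 = trans (bound-3 n%4≡3) (begin
  2 * n + 2               ≡⟨ +-comm (2 * n) 2 ⟩
  suc (suc (n + (n + 0))) ≡⟨ cong (λ k → suc (suc (n + k))) (+-identityʳ n) ⟩
  suc (suc (n + n))       ≡⟨ cong suc (sym (+-suc n n)) ⟩
  suc n + suc n           ∎)
  where
  bound-3 : n % 4 ≡ 3 → bound n ≡ 2 * n + 2
  bound-3 eq with n % 4
  bound-3 refl | .3 = refl
... | no n%4≢3 = trans (bound-other n%4≢3) (cong (n +_) (+-identityʳ n))
  where
  bound-other : n % 4 ≢ 3 → bound n ≡ 2 * n
  bound-other ne with n % 4
  ... | 0 = refl
  ... | 1 = refl
  ... | 2 = refl
  ... | 3 = ⊥-elim (ne refl)
  ... | suc (suc (suc (suc _))) = refl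

suc-≤-classBound : ∀ {k} → k ≤ suc m → ([ suc m ]₄ ≢ 3₄ → k ≤ m) → suc k ≤ classBound (suc m)
suc-≤-classBound {m} k≤n k≤m with suc m % 4 ≟ 3
... | yes _ = s≤s k≤n
... | no n%4≢3 = s≤s (k≤m (λ n≡3 → n%4≢3 (%4-from-[]₄ (suc m) n≡3)))

-- A family with all pairwise distances ≡ 2 (mod 4) has at most classBound n
-- members: translated by one member F, the others form a two-code.
distance₂-family-bound : (K : List (Subset (suc m))) → AllPairs Distance₂ K →
  length K ≤ classBound (suc m)
distance₂-family-bound [] _ = z≤n
distance₂-family-bound {m} (F ∷ R) (row ∷ d₂) =
  subst (λ k → suc k ≤ classBound (suc m)) (length-map (F ⊕_) R)
    (suc-≤-classBound (two-code-bound T T-weights T-distances)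
                      (λ n≢3 → two-code-sharp n≢3 T T-weights T-distances))
  where
  T = map (F ⊕_) R
  T-weights : All Weight₂ T
  T-weights = All-map⁺ row
  T-distances : AllPairs Distance₂ T
  T-distances = AllPairs-map⁺ (AllPairs.map (λ {G} {H} G₂H → trans (cong wt (⊕-translate F G H)) G₂H) d₂)

length-filter-split : {A : Set} {P : A → Set} (P? : Decidable P) (xs : List A) →
  length (filter P? xs) + length (filter (∁? P?) xs) ≡ length xs
length-filter-split P? [] = refl
length-filter-split P? (x ∷ xs) with P? x
... | yes _ = cong suc (length-filter-split P? xs)
... | no _ = trans (+-suc _ _) (cong suc (length-filter-split P? xs))

-- Within one parity class distances are even, so apart means ≡ 2 (mod 4).
same-parity⇒distance₂ : (F G : Subset n) → parity F ≡ parity G → Apart F G → Distance₂ F G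
same-parity⇒distance₂ F G same apart = even-nonzero
  (trans (parity-⊕ F G) (trans (cong (_xor parity G) same) (xor-same (parity G)))) apart

parity-class-bound : {c : Bool} (K : List (Subset (suc m))) → All (λ F → parity F ≡ c) K →
  AllPairs Apart K → length K ≤ classBound (suc m)
parity-class-bound K parities apart = distance₂-family-bound K (allPairs-refine
  (λ {F} {G} F≡c G≡c → same-parity⇒distance₂ F G (trans F≡c (sym G≡c))) parities apart)

upper-bound : (𝓕 : List (Subset (suc m))) → Good 𝓕 → length 𝓕 ≤ bound (suc m)
upper-bound {m} 𝓕 good =
  subst₂ _≤_ (length-filter-split odd? 𝓕) (sym (bound≡2×classBound (suc m)))
    (+-mono-≤ (parity-class-bound odds (all-filter odd? 𝓕) (filter⁺ odd? apart))
              (parity-class-bound evens evens-even (filter⁺ (∁? odd?) apart)))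
  where
  odd? : Decidable (λ (F : Subset (suc m)) → parity F ≡ true)
  odd? F = parity F Bool.≟ true
  odds = filter odd? 𝓕
  evens = filter (∁? odd?) 𝓕
  evens-even : All (λ F → parity F ≡ false) evens
  evens-even = All.map ¬-not (all-filter (∁? odd?) 𝓕)
  apart : AllPairs Apart 𝓕
  apart = AllPairs.map (λ {F} {G} → ¬4∣d⇒apart F G) good

Odd : Subset n → Set
Odd v = parity v ≡ true

wt-⁅⁆ : (i : Fin n) → wt ⁅ i ⁆ ≡ 1₄
wt-⁅⁆ i = cong [_]₄ (∣⁅x⁆∣≡1 i)

⁅⁆-distance₂ : {i j : Fin n} → i ≢ j → Distance₂ ⁅ i ⁆ ⁅ j ⁆
⁅⁆-distance₂ {i = zero} {zero} i≢j = ⊥-elim (i≢j refl)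
⁅⁆-distance₂ {i = zero} {suc j} _ = cong inc (trans (cong wt (⊕-identityˡ ⁅ j ⁆)) (wt-⁅⁆ j))
⁅⁆-distance₂ {i = suc i} {zero} _ = cong inc (trans (cong wt (⊕-identityʳ ⁅ i ⁆)) (wt-⁅⁆ i))
⁅⁆-distance₂ {i = suc i} {suc j} i≢j = ⁅⁆-distance₂ (λ i≡j → i≢j (cong suc i≡j))

-- For n ≡ 3 (mod 4) the full set is at distance n - 1 ≡ 2 from each singleton.
⊤-⁅⁆-distance₂ : [ n ]₄ ≡ 3₄ → (i : Fin n) → Distance₂ ⊤ ⁅ i ⁆
⊤-⁅⁆-distance₂ {n} n≡3 i = trans (wt-⊕ ⊤ ⁅ i ⁆)
  (cong₂ (λ x b → x +₄ twice b) (cong₂ _+₄_ (trans (wt-⊤ {n}) n≡3) (wt-⁅⁆ i))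
    (trans (⟨⟩-comm ⊤ ⁅ i ⁆) (trans (⟨⟩-⊤ ⁅ i ⁆) (cong isOdd (wt-⁅⁆ i)))))

odd-two-code : ∀ n → Σ (List (Subset n)) λ C →
  All Odd C × AllPairs Distance₂ C × length C ≡ classBound n
odd-two-code n with n % 4 ≟ 3
... | yes n%4≡3 =
  ⊤ ∷ singletons , (⊤-odd ∷ singletons-odd) ,
  (tabulate⁺ (⊤-⁅⁆-distance₂ n≡3) ∷ singletons-distance₂) , cong suc (length-tabulate ⁅_⁆)
  where
  singletons = tabulate ⁅_⁆
  singletons-odd = tabulate⁺ (λ i → cong isOdd (wt-⁅⁆ i))
  singletons-distance₂ = AllPairs-tabulate⁺ ⁅⁆-distance₂
  n≡3 : [ n ]₄ ≡ 3₄
  n≡3 = []₄-from-%4 n n%4≡3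
  ⊤-odd : Odd (⊤ {n})
  ⊤-odd = cong isOdd (trans (wt-⊤ {n}) n≡3)
... | no _ = tabulate ⁅_⁆ , tabulate⁺ (λ i → cong isOdd (wt-⁅⁆ i)) ,
  AllPairs-tabulate⁺ ⁅⁆-distance₂ , length-tabulate ⁅_⁆

-- Doubling an odd two-code C by an odd translation t: distances within C
-- and within t ⊕ C are ≡ 2, distances across are odd.
doubling-good : (C : List (Subset n)) (t : Subset n) → All Odd C → Odd t →
  AllPairs Distance₂ C → Good (C ++ map (t ⊕_) C)
doubling-good {n} C t odd-C odd-t d₂ =
  AllPairs.map (λ {F} {G} → apart⇒¬4∣d F G) (++⁺ within-C within-tC across)
  where
  distance₂⇒apart : (F G : Subset n) → Distance₂ F G → Apart F G
  distance₂⇒apart F G F₂G F₀G with () ← trans (sym F₂G) F₀G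
  within-C : AllPairs Apart C
  within-C = AllPairs.map (λ {F} {G} → distance₂⇒apart F G) d₂
  within-tC : AllPairs Apart (map (t ⊕_) C)
  within-tC = AllPairs-map⁺ (AllPairs.map (λ {F} {G} F₂G →
    distance₂⇒apart (t ⊕ F) (t ⊕ G) (trans (cong wt (⊕-translate t F G)) F₂G)) d₂)
  odd⇒apart : (v : Subset n) → Odd v → wt v ≢ 0₄
  odd⇒apart v v-odd v≡0 = not-¬ refl (trans (sym v-odd) (cong isOdd v≡0))
  odd-across : (F G : Subset n) → Odd F → Odd G → Odd (F ⊕ (t ⊕ G))
  odd-across F G F-odd G-odd =
    trans (parity-⊕ F (t ⊕ G)) (cong₂ _xor_ F-odd (trans (parity-⊕ t G) (cong₂ _xor_ odd-t G-odd)))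
  across : All (λ F → All (Apart F) (map (t ⊕_) C)) C
  across = All.map (λ {F} F-odd → All-map⁺ (All.map (λ {G} G-odd →
    odd⇒apart (F ⊕ (t ⊕ G)) (odd-across F G F-odd G-odd)) odd-C)) odd-C

extremal-family : ∀ m → Σ (List (Subset (suc m))) (λ 𝓕 → Good 𝓕 × length 𝓕 ≡ bound (suc m))
extremal-family m with odd-two-code (suc m)
... | C , odd-C , d₂ , length-C =
  C ++ map (⁅ zero ⁆ ⊕_) C ,
  doubling-good C ⁅ zero ⁆ odd-C (cong isOdd (wt-⁅⁆ {suc m} zero)) d₂ ,
  (begin
    length (C ++ map (⁅ zero ⁆ ⊕_) C)        ≡⟨ length-++ C ⟩
    length C + length (map (⁅ zero ⁆ ⊕_) C)  ≡⟨ cong (length C +_) (length-map (⁅ zero ⁆ ⊕_) C) ⟩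
    length C + length C                      ≡⟨ cong₂ _+_ length-C length-C ⟩
    classBound (suc m) + classBound (suc m)  ≡⟨ sym (bound≡2×classBound (suc m)) ⟩
    bound (suc m)                            ∎)

theorem1p1 : (n : ℕ) → 1 ≤ n →
    ((𝓕 : List (Subset n)) → Good 𝓕 → length 𝓕 ≤ bound n)
    × Σ (List (Subset n)) (λ 𝓕 → Good 𝓕 × length 𝓕 ≡ bound n)
theorem1p1 zero ()
theorem1p1 (suc m) _ = upper-bound , extremal-family m
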